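{- Let $\mathcal{X}=(\Omega,S)$ be a schurian pseudo-TI scheme of valency $k$ and index $n/m$, where $n=|\Omega|$ and $m=|S_1|$. If $n/m>2k(k-1)$, then $\mathcal{X}$ is a TI-scheme.
   Context: A coherent configuration on a finite set $\Omega$ is a pair $(\Omega,S)$, where $S$ is a partition of $\Omega\times\Omega$ such that the diagonal $1_\Omega$ is a union of elements of $S$, $S$ is closed under $s\mapsto s^*=\{(\beta,\alpha):(\alpha,\beta)\in s\}$, and for $r,s,t\in S$ the number $c_{rs}^t=|\alpha r\cap\beta s^*|$ (where $\alpha r=\{\beta:(\alpha,\beta)\in r\}$) does not depend on $(\alpha,\beta)\in t$. It is homogeneous if $1_\Omega\in S$; then $n_s=|\alpha s|$ is the valency of $s$ and $S_j=\{s\in S:n_s=j\}$. The indistinguishing number is $c=\max_{r\in S\setminus\{1_\Omega\}}\sum_{s\in S}c_{ss^*}^r$. A homogeneous coherent configuration with maximum valency $k$ is a pseudo-TI scheme of valency $k$ and index $n/m$ if $S=S_1\cup S_k$ and $c\le mk$. It is schurian if $S$ is the set of orbits on $\Omega\times\Omega$ of some permutation group on $\Omega$. A subgroup $H\le G$ is a TI-subgroup if $H^g\cap H\in\{H,1\}$ for all $g\in G$. A TI-scheme is the coherent configuration associated with some transitive permutation group whose one-point stabilizer is a TI-subgroup. -}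

module Defs where

open import Data.Nat using (ℕ; zero; suc; _+_; _*_; _≤_)
open import Data.Fin using (Fin; zero; suc; _≟_)
open import Data.Fin.Properties using (all?)
open import Data.Product using (Σ; ∃; ∃₂; _×_; _,_)
open import Data.Sum using (_⊎_)
open import Function using (_∘_; _⇔_)
open import Relation.Nullary using (Dec; yes; no; ¬_)
open import Relation.Nullary.Decidable using (_×-dec_)
open import Relation.Binary.PropositionalEquality using (_≡_)
open import Data.Fin.Permutation using (Permutation′; _⟨$⟩ʳ_; id; flip; _∘ₚ_; _≈_)

count : ∀ {n} (P : Fin n → Set) → (∀ x → Dec (P x)) → ℕ
count {zero} P d = 0
count {suc n} P d with d zero
... | yes _ = suc (count (P ∘ suc) (d ∘ suc))
... | no _ = count (P ∘ suc) (d ∘ suc)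

sumFin : ∀ {r} → (Fin r → ℕ) → ℕ
sumFin {zero} f = 0
sumFin {suc r} f = f zero + sumFin (f ∘ suc)

-- A partition S of Ω × Ω (Ω = Fin n) into r classes is encoded by a
-- surjective map  rel : Ω → Ω → Fin r  ((α,β) ∈ class s  iff  rel α β ≡ s).

-- α s = { β : (α,β) ∈ s }
-- c_{rs}^t(α,β) = |α r ∩ β s*| with  γ ∈ β s*  iff (β,γ) ∈ s*
interNum : ∀ {n r} (rel : Fin n → Fin n → Fin r) (star : Fin r → Fin r)
           → Fin r → Fin r → Fin n → Fin n → ℕ
interNum rel star r s α β =
  count (λ γ → rel α γ ≡ r × rel β γ ≡ star s)
        (λ γ → (rel α γ ≟ r) ×-dec (rel β γ ≟ star s))

record IsCoherentConfiguration {n r : ℕ} (rel : Fin n → Fin n → Fin r) : Set where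
  field
    nonempty : ∀ s → ∃₂ λ α β → rel α β ≡ s
    -- the diagonal 1_Ω is a union of classes
    diag-union : ∀ α β γ → rel α α ≡ rel β γ → β ≡ γ
    -- S is closed under s ↦ s*
    star : Fin r → Fin r
    star-spec : ∀ α β → rel β α ≡ star (rel α β)
    regular : ∀ r s α β α′ β′ → rel α β ≡ rel α′ β′
              → interNum rel star r s α β ≡ interNum rel star r s α′ β′

IsHomogeneous : ∀ {n r} (rel : Fin n → Fin n → Fin r) → Set
IsHomogeneous {n} {r} rel =
  Σ (Fin r) λ d → (∀ α → rel α α ≡ d) × (∀ α β → rel α β ≡ d → α ≡ β)

HasValency : ∀ {n r} (rel : Fin n → Fin n → Fin r) → Fin r → ℕ → Set
HasValency rel s j =
  ∀ α → count (λ β → rel α β ≡ s) (λ β → rel α β ≟ s) ≡ j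

hasValency? : ∀ {n r} (rel : Fin n → Fin n → Fin r) s j → Dec (HasValency rel s j)
hasValency? rel s j = all? (λ α → count (λ β → rel α β ≡ s) (λ β → rel α β ≟ s) Data.Nat.≟ j)
  where import Data.Nat

numThin : ∀ {n r} (rel : Fin n → Fin n → Fin r) → ℕ
numThin {n} {r} rel = count (λ s → HasValency rel s 1) (λ s → hasValency? rel s 1)

indistSum : ∀ {n r} (rel : Fin n → Fin n → Fin r) → IsCoherentConfiguration rel
            → Fin n → Fin n → ℕ
indistSum rel cc α β =
  sumFin (λ s → interNum rel star s (star s) α β)
  where open IsCoherentConfiguration cc

-- pseudo-TI scheme of valency k (and index n/m, m = |S_1|):
-- maximum valency k, S = S_1 ∪ S_k, and c ≤ m k
-- (c ≤ m k  is stated as: for every r ≠ 1_Ω and (α,β) ∈ r the sum is ≤ m k)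
IsPseudoTI : ∀ {n r} (rel : Fin n → Fin n → Fin r) → IsCoherentConfiguration rel
             → ℕ → Set
IsPseudoTI {n} {r} rel cc k =
  (∀ s → HasValency rel s 1 ⊎ HasValency rel s k)
  × (Σ (Fin r) λ s → HasValency rel s k)
  × (∀ α β → ¬ (α ≡ β) → indistSum rel cc α β ≤ numThin rel * k)

record IsPermGroup {n : ℕ} (G : Permutation′ n → Set) : Set where
  field
    id∈ : G id
    ∘∈  : ∀ {π σ} → G π → G σ → G (π ∘ₚ σ)
    inv∈ : ∀ {π} → G π → G (flip π)
    resp : ∀ {π σ} → π ≈ σ → G π → G σ

OrbitalsOf : ∀ {n r} (rel : Fin n → Fin n → Fin r) (G : Permutation′ n → Set) → Set
OrbitalsOf {n} rel G =
  ∀ α β α′ β′ → (rel α β ≡ rel α′ β′)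
    ⇔ (Σ (Permutation′ n) λ g → G g × g ⟨$⟩ʳ α ≡ α′ × g ⟨$⟩ʳ β ≡ β′)

IsSchurian : ∀ {n r} (rel : Fin n → Fin n → Fin r) → Set₁
IsSchurian {n} rel =
  Σ (Permutation′ n → Set) λ G → IsPermGroup G × OrbitalsOf rel G

IsTransitive : ∀ {n} (G : Permutation′ n → Set) → Set
IsTransitive {n} G = ∀ α β → Σ (Permutation′ n) λ g → G g × g ⟨$⟩ʳ α ≡ β

Stab : ∀ {n} (G : Permutation′ n → Set) → Fin n → Permutation′ n → Set
Stab G α x = G x × x ⟨$⟩ʳ α ≡ α

Conj : ∀ {n} (H : Permutation′ n → Set) → Permutation′ n → Permutation′ n → Set
Conj {n} H g x = Σ (Permutation′ n) λ h → H h × x ≈ (flip g ∘ₚ h ∘ₚ g)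

IsTISubgroup : ∀ {n} (G H : Permutation′ n → Set) → Set
IsTISubgroup {n} G H =
  ∀ g → G g →
    (∀ x → H x → Conj H g x)
    ⊎ (∀ x → Conj H g x → H x → x ≈ id)

IsTIScheme : ∀ {n r} (rel : Fin n → Fin n → Fin r) → Set₁
IsTIScheme {n} rel =
  Σ (Permutation′ n → Set) λ G →
    IsPermGroup G × IsTransitive G × OrbitalsOf rel G
    × (∀ α → IsTISubgroup G (Stab G α))

-- Let G be a group whose orbitals are the classes and H = G_α. Since the scheme is
-- schurian, the H-orbits on Ω are the sets α s: m of them have size 1, the others size k.
-- Burnside's double count T = ∑_{x ∈ H} |Fix x| = ∑_γ |H_γ| is estimated twice:
--   * by orbit–stabilizer,  k·T = n·|H| + m(k−1)·|H|;
--   * a non-identity x ∈ H moving δ fixes only points γ with r(δ,γ) = r(xδ,γ), at most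
--     ∑_s c_{ss*}^{r(δ,xδ)} ≤ mk of them, so  T + mk ≤ n + |H|·mk.
-- If some x ≠ 1 in H fixes a point β with r(α,β) of valency k, then |H| = k·|H_β| ≥ 2k and
-- the two estimates force n ≤ 2k(k−1)m. Hence H ∩ H^g = 1 when r(α,gα) is not thin, while
-- H ⊆ H^g when it is thin: H is a TI-subgroup.

module Submission where

open import Defs
open import Data.Nat using (ℕ; zero; suc; _+_; _*_; _∸_; _^_; _<_; _≤_; z≤n; s≤s)
open import Data.Nat.Properties
  using (+-*-semiring; *-distribˡ-+; +-identityʳ; *-identityʳ; *-zeroʳ; *-comm; +-mono-≤; *-monoʳ-≤;
         m+[n∸m]≡n; ≤-refl; ≤-reflexive; ≤-trans; m≤n⇒∃[o]m+o≡n; m+1+n≰m)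
open import Data.Fin using (Fin; zero; suc; _≟_; combine; finToFun; funToFin)
open import Data.Fin.Properties using (all?; ¬∀⟶∃¬; suc-injective; finToFun-funToFin; funToFin-finToFin)
open import Data.Fin.Permutation
  using (Permutation′; permutation; _⟨$⟩ʳ_; _⟨$⟩ˡ_; id; flip; _∘ₚ_; inverseˡ; inverseʳ)
open import Data.Product using (Σ; ∃; _×_; _,_)
open import Data.Sum using (_⊎_; inj₁; inj₂)
open import Data.Empty using (⊥; ⊥-elim)
open import Function using (_∘_; Equivalence)
open import Relation.Nullary using (Dec; yes; no; ¬_)
open import Relation.Nullary.Decidable using (_×-dec_; decidable-stable; ¬¬-excluded-middle)
open import Relation.Binary.PropositionalEquality
  using (_≡_; _≢_; refl; sym; trans; cong; cong₂; subst; subst₂; module ≡-Reasoning)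
open import Algebra.Properties.Semiring.Sum +-*-semiring
  using (sum; sum-cong-≗; ∑-distrib-+; ∑-comm; ∑-permute; *-distribˡ-sum; *-distribʳ-sum)
open import Data.Nat.Tactic.RingSolver using (solve-∀)

χ : ∀ {p} {P : Set p} → Dec P → ℕ
χ (yes _) = 1
χ (no _)  = 0

χ-yes : ∀ {p} {P : Set p} (d : Dec P) → P → χ d ≡ 1
χ-yes (yes _) _  = refl
χ-yes (no ¬p) p = ⊥-elim (¬p p)

χ≤1 : ∀ {p} {P : Set p} (d : Dec P) → χ d ≤ 1
χ≤1 (yes _) = s≤s z≤n
χ≤1 (no _)  = z≤n

χ-cong : ∀ {p q} {P : Set p} {Q : Set q} (d : Dec P) (e : Dec Q) → (P → Q) → (Q → P) → χ d ≡ χ e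
χ-cong (yes _) (yes _) _ _ = refl
χ-cong (yes p) (no ¬q) f _ = ⊥-elim (¬q (f p))
χ-cong (no ¬p) (yes q) _ g = ⊥-elim (¬p (g q))
χ-cong (no _)  (no _)  _ _ = refl

χ-mono : ∀ {p q} {P : Set p} {Q : Set q} (d : Dec P) (e : Dec Q) → (P → Q) → χ d ≤ χ e
χ-mono (yes p) (yes _) _ = ≤-refl
χ-mono (yes p) (no ¬q) f = ⊥-elim (¬q (f p))
χ-mono (no _)  _       _ = z≤n

χ-× : ∀ {p q} {P : Set p} {Q : Set q} (d : Dec P) (e : Dec Q) → χ (d ×-dec e) ≡ χ d * χ e
χ-× (yes _) (yes _) = refl
χ-× (yes _) (no _)  = refl
χ-× (no _)  (yes _) = refl
χ-× (no _)  (no _)  = refl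

sumFin≡sum : ∀ {n} (f : Fin n → ℕ) → sumFin f ≡ sum f
sumFin≡sum {zero}  f = refl
sumFin≡sum {suc n} f = cong (f zero +_) (sumFin≡sum (f ∘ suc))

count≡sum : ∀ {n} (P : Fin n → Set) (P? : ∀ x → Dec (P x)) → count P P? ≡ sum (χ ∘ P?)
count≡sum {zero}  P P? = refl
count≡sum {suc n} P P? with P? zero
... | yes _ = cong suc (count≡sum (P ∘ suc) (P? ∘ suc))
... | no _  = count≡sum (P ∘ suc) (P? ∘ suc)

sum-mono : ∀ {n} {f g : Fin n → ℕ} → (∀ i → f i ≤ g i) → sum f ≤ sum g
sum-mono {zero}  _ = z≤n
sum-mono {suc n} f≤g = +-mono-≤ (f≤g zero) (sum-mono (f≤g ∘ suc))

sum-const : ∀ n (c : ℕ) → sum {n} (λ _ → c) ≡ n * c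
sum-const zero    c = refl
sum-const (suc n) c = cong (c +_) (sum-const n c)

sum-delta : ∀ {n} (c : Fin n) (h : Fin n → ℕ) → sum (λ i → χ (i ≟ c) * h i) ≡ h c
sum-delta {suc n} zero h = begin
  h zero + 0 + sum {n} (λ _ → 0)
    ≡⟨ cong₂ _+_ (+-identityʳ (h zero)) (trans (sum-const n 0) (*-zeroʳ n)) ⟩
  h zero + 0
    ≡⟨ +-identityʳ (h zero) ⟩
  h zero ∎
  where open ≡-Reasoning
sum-delta {suc n} (suc c) h = begin
  0 + sum (λ i → χ (suc i ≟ suc c) * h (suc i))
    ≡⟨ sum-cong-≗ (λ i → cong (_* h (suc i)) (χ-cong (suc i ≟ suc c) (i ≟ c) suc-injective (cong suc))) ⟩
  sum (λ i → χ (i ≟ c) * h (suc i))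
    ≡⟨ sum-delta c (h ∘ suc) ⟩
  h (suc c) ∎
  where open ≡-Reasoning

sum-indicator : ∀ {n} (c : Fin n) → sum (λ i → χ (i ≟ c)) ≡ 1
sum-indicator c = trans (sum-cong-≗ (λ i → sym (*-identityʳ (χ (i ≟ c))))) (sum-delta c (λ _ → 1))

χ-weight≤ : ∀ {p} {P : Set p} (d : Dec P) (x : ℕ) → χ d * x ≤ x
χ-weight≤ (yes _) x = ≤-reflexive (+-identityʳ x)
χ-weight≤ (no _)  x = z≤n

sum-single : ∀ {n} (c : Fin n) (h : Fin n → ℕ) → h c ≤ sum h
sum-single c h = subst (_≤ sum h) (sum-delta c h) (sum-mono (λ i → χ-weight≤ (i ≟ c) (h i)))

sum-two : ∀ {n} {a b : Fin n} → a ≢ b → (h : Fin n → ℕ) → h a + h b ≤ sum h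
sum-two {a = a} {b} a≢b h =
  subst (_≤ sum h)
    (trans (∑-distrib-+ (λ i → χ (i ≟ a) * h i) (λ i → χ (i ≟ b) * h i))
           (cong₂ _+_ (sum-delta a h) (sum-delta b h)))
    (sum-mono (λ i → disjoint (i ≟ a) (i ≟ b) (h i)))
  where
  disjoint : ∀ {i} (d : Dec (i ≡ a)) (e : Dec (i ≡ b)) x → χ d * x + χ e * x ≤ x
  disjoint (yes i≡a) (yes i≡b) x = ⊥-elim (a≢b (trans (sym i≡a) i≡b))
  disjoint (yes _)   (no _)    x = ≤-reflexive (trans (+-identityʳ _) (+-identityʳ x))
  disjoint (no _)    (yes _)   x = ≤-reflexive (+-identityʳ x)
  disjoint (no _)    (no _)    x = z≤n

count-mono : ∀ {n} {P Q : Fin n → Set} (P? : ∀ x → Dec (P x)) (Q? : ∀ x → Dec (Q x))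
  → (∀ x → P x → Q x) → sum (χ ∘ P?) ≤ sum (χ ∘ Q?)
count-mono P? Q? P⇒Q = sum-mono (λ x → χ-mono (P? x) (Q? x) (P⇒Q x))

count-positive : ∀ {n} (P : Fin n → Set) (P? : ∀ x → Dec (P x)) {a} → P a → 1 ≤ count P P?
count-positive P P? {a} pa =
  subst₂ _≤_ (χ-yes (P? a) pa) (sym (count≡sum P P?)) (sum-single a (χ ∘ P?))

count-unique : ∀ {n} (P : Fin n → Set) (P? : ∀ x → Dec (P x)) → count P P? ≡ 1
  → ∀ {a b} → P a → P b → a ≡ b
count-unique P P? count≡1 {a} {b} pa pb with a ≟ b
... | yes a≡b = a≡b
... | no a≢b  = ⊥-elim (2≰1 (subst₂ _≤_
      (cong₂ _+_ (χ-yes (P? a) pa) (χ-yes (P? b) pb))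
      (trans (sym (count≡sum P P?)) count≡1)
      (sum-two a≢b (χ ∘ P?))))
  where
  2≰1 : ¬ (2 ≤ 1)
  2≰1 (s≤s ())

sum-bounded-off-point : ∀ {N} {X : Fin N → Set} (X? : ∀ c → Dec (X c)) (f : Fin N → ℕ)
  {c₀ : Fin N} {B : ℕ} → X c₀ → (∀ c → X c → c ≢ c₀ → f c ≤ B)
  → sum (λ c → χ (X? c) * f c) + B ≤ f c₀ + sum (χ ∘ X?) * B
sum-bounded-off-point {X = X} X? f {c₀} {B} x₀ bound =
  subst₂ _≤_
    (trans (∑-distrib-+ (λ c → χ (X? c) * f c) (λ c → χ (c ≟ c₀) * B))
           (cong (sum (λ c → χ (X? c) * f c) +_) (sum-delta c₀ (λ _ → B))))
    (trans (∑-distrib-+ (λ c → χ (c ≟ c₀) * f c) (λ c → χ (X? c) * B))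
           (cong₂ _+_ (sum-delta c₀ f) (sym (*-distribʳ-sum B (χ ∘ X?)))))
    (sum-mono pointwise)
  where
  pointwise : ∀ c → χ (X? c) * f c + χ (c ≟ c₀) * B ≤ χ (c ≟ c₀) * f c + χ (X? c) * B
  pointwise c with c ≟ c₀ | X? c
  ... | yes refl | yes _ = ≤-refl
  ... | yes refl | no ¬x = ⊥-elim (¬x x₀)
  ... | no c≢c₀  | yes x = ≤-trans (≤-reflexive (trans (+-identityʳ _) (+-identityʳ _)))
                                   (≤-trans (bound c x c≢c₀) (≤-reflexive (sym (+-identityʳ B))))
  ... | no _     | no _  = z≤n

¬¬-∀Fin : ∀ {n} {Q : Fin n → Set} → (∀ i → ¬ ¬ Q i) → ¬ ¬ (∀ i → Q i)
¬¬-∀Fin {zero}  _   k = k (λ ())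
¬¬-∀Fin {suc n} ¬¬Q k =
  ¬¬Q zero (λ q₀ → ¬¬-∀Fin (¬¬Q ∘ suc) (λ qs → k (λ { zero → q₀ ; (suc i) → qs i })))

funToFin-cong : ∀ {m k} {f g : Fin m → Fin k} → (∀ i → f i ≡ g i) → funToFin f ≡ funToFin g
funToFin-cong {zero}  _   = refl
funToFin-cong {suc m} f≗g = cong₂ combine (f≗g zero) (funToFin-cong (f≗g ∘ suc))

-- Self-maps of Fin n are enumerated by codes in Fin (n ^ n), so finite sums
-- over codes let us count the elements of a permutation group.
module MapCodes (n : ℕ) where

  Code : Set
  Code = Fin (n ^ n)

  decode : Code → Fin n → Fin n
  decode = finToFun

  encode : (Fin n → Fin n) → Code
  encode = funToFin

  decode-encode : ∀ (f : Fin n → Fin n) i → decode (encode f) i ≡ f i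
  decode-encode = finToFun-funToFin

  decode-injective : ∀ {c c′ : Code} → (∀ i → decode c i ≡ decode c′ i) → c ≡ c′
  decode-injective {c = c} {c′} c≗c′ =
    trans (sym (funToFin-finToFin {n} {n} c))
          (trans (funToFin-cong c≗c′) (funToFin-finToFin {n} {n} c′))

  identityCode : Code
  identityCode = encode (λ i → i)

  nonidentity-moves : ∀ {c : Code} → c ≢ identityCode → ∃ λ δ → decode c δ ≢ δ
  nonidentity-moves {c} c≢id with all? (λ i → decode c i ≟ i)
  ... | yes fixesAll =
    ⊥-elim (c≢id (decode-injective (λ i → trans (fixesAll i) (sym (decode-encode _ i)))))
  ... | no ¬fixesAll = ¬∀⟶∃¬ n _ (λ i → decode c i ≟ i) ¬fixesAll

  leftMul : Permutation′ n → Permutation′ (n ^ n)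
  leftMul g = permutation (compose (g ⟨$⟩ʳ_)) (compose (g ⟨$⟩ˡ_))
    (cancel (g ⟨$⟩ʳ_) (g ⟨$⟩ˡ_) (λ _ → inverseʳ g)) (cancel (g ⟨$⟩ˡ_) (g ⟨$⟩ʳ_) (λ _ → inverseˡ g))
    where
    compose : (Fin n → Fin n) → Code → Code
    compose f c = encode (λ i → f (decode c i))
    cancel : ∀ (f f′ : Fin n → Fin n) → (∀ i → f (f′ i) ≡ i) → ∀ c → compose f (compose f′ c) ≡ c
    cancel f f′ ff′ c = decode-injective λ i →
      trans (decode-encode _ i) (trans (cong f (decode-encode _ i)) (ff′ _))

  leftMul-decode : ∀ (g : Permutation′ n) c i → decode (leftMul g ⟨$⟩ʳ c) i ≡ g ⟨$⟩ʳ decode c i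
  leftMul-decode g c = decode-encode _

  Represents : ∀ (K : Permutation′ n → Set) → Code → Set
  Represents K c = Σ (Permutation′ n) λ π → K π × (∀ i → π ⟨$⟩ʳ i ≡ decode c i)

fixedPoints : ∀ {n} → (Fin n → Fin n) → ℕ
fixedPoints f = sum (λ γ → χ (γ ≟ f γ))

fixedPoints≤n : ∀ {n} (f : Fin n → Fin n) → fixedPoints f ≤ n
fixedPoints≤n {n} f =
  subst (fixedPoints f ≤_) (trans (sum-const n 1) (*-identityʳ n))
        (sum-mono (λ γ → χ≤1 (γ ≟ f γ)))

module GroupCounting {n : ℕ} {K : Permutation′ n → Set} (K-group : IsPermGroup K)
                     (member? : ∀ c → Dec (MapCodes.Represents n K c)) where

  open MapCodes n
  open IsPermGroup K-group

  represents-identity : Represents K identityCode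
  represents-identity = id , id∈ , λ i → sym (decode-encode _ i)

  represents-leftMul : ∀ {g c} → K g → Represents K c → Represents K (leftMul g ⟨$⟩ʳ c)
  represents-leftMul {g} {c} Kg (π , Kπ , π≗c) =
    π ∘ₚ g , ∘∈ Kπ Kg , λ i → trans (cong (g ⟨$⟩ʳ_) (π≗c i)) (sym (leftMul-decode g c i))

  order : ℕ
  order = sum (χ ∘ member?)

  fibre : Fin n → Fin n → ℕ
  fibre γ δ = sum (λ c → χ (member? c) * χ (δ ≟ decode c γ))

  stab : Fin n → ℕ
  stab γ = fibre γ γ

  -- every element of K maps γ somewhere
  order≡∑fibre : ∀ γ → order ≡ sum (fibre γ)
  order≡∑fibre γ = begin
    sum (χ ∘ member?)
      ≡⟨ sum-cong-≗ (λ c → sym (trans (cong (χ (member? c) *_) (sum-indicator (decode c γ))) (*-identityʳ _))) ⟩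
    sum (λ c → χ (member? c) * sum (λ δ → χ (δ ≟ decode c γ)))
      ≡⟨ sum-cong-≗ (λ c → *-distribˡ-sum (χ (member? c)) (λ δ → χ (δ ≟ decode c γ))) ⟩
    sum (λ c → sum (λ δ → χ (member? c) * χ (δ ≟ decode c γ)))
      ≡⟨ ∑-comm (λ c δ → χ (member? c) * χ (δ ≟ decode c γ)) ⟩
    sum (fibre γ) ∎
    where open ≡-Reasoning

  -- if g ∈ K maps γ to δ, left multiplication by g⁻¹ matches the fibre over δ with K_γ
  fibre-in-orbit : ∀ {γ δ g} → K g → g ⟨$⟩ʳ γ ≡ δ → fibre γ δ ≡ stab γ
  fibre-in-orbit {γ} {δ} {g} Kg gγ≡δ = begin
    sum (λ c → χ (member? c) * χ (δ ≟ decode c γ))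
      ≡⟨ sum-cong-≗ (λ c → cong₂ _*_ (same-member c) (same-point c)) ⟩
    sum (λ c → χ (member? (g⁻¹· c)) * χ (γ ≟ decode (g⁻¹· c) γ))
      ≡⟨ sym (∑-permute (λ c → χ (member? c) * χ (γ ≟ decode c γ)) (leftMul (flip g))) ⟩
    stab γ ∎
    where
    open ≡-Reasoning
    g⁻¹·_ : Code → Code
    g⁻¹· c = leftMul (flip g) ⟨$⟩ʳ c
    same-member : ∀ c → χ (member? c) ≡ χ (member? (g⁻¹· c))
    same-member c = χ-cong (member? c) (member? (g⁻¹· c))
      (represents-leftMul (inv∈ Kg))
      (λ r → subst (Represents K) (inverseʳ (leftMul g)) (represents-leftMul Kg r))
    same-point : ∀ c → χ (δ ≟ decode c γ) ≡ χ (γ ≟ decode (g⁻¹· c) γ)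
    same-point c = χ-cong (δ ≟ decode c γ) (γ ≟ decode (g⁻¹· c) γ)
      (λ δ≡cγ → trans (sym (trans (cong (g ⟨$⟩ˡ_) (sym gγ≡δ)) (inverseˡ g)))
                      (trans (cong (g ⟨$⟩ˡ_) δ≡cγ) (sym (leftMul-decode (flip g) c γ))))
      (λ γ≡g⁻¹cγ → trans (sym gγ≡δ)
                         (trans (cong (g ⟨$⟩ʳ_) (trans γ≡g⁻¹cγ (leftMul-decode (flip g) c γ)))
                                (inverseʳ g)))

  fibre-off-orbit : ∀ {γ δ} → (∀ g → K g → g ⟨$⟩ʳ γ ≢ δ) → fibre γ δ ≡ 0
  fibre-off-orbit {γ} {δ} unreachable =
    trans (sum-cong-≗ term≡0) (trans (sum-const (n ^ n) 0) (*-zeroʳ (n ^ n)))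
    where
    term≡0 : ∀ c → χ (member? c) * χ (δ ≟ decode c γ) ≡ 0
    term≡0 c with member? c | δ ≟ decode c γ
    ... | yes (π , Kπ , π≗c) | yes δ≡ = ⊥-elim (unreachable π Kπ (trans (π≗c γ) (sym δ≡)))
    ... | yes _ | no _ = refl
    ... | no _  | _    = refl

  -- orbit–stabilizer: |K| = |γ^K| · |K_γ|, for a decidable description O of the orbit γ^K
  orbit-stabilizer : ∀ γ (O : Fin n → Set) (O? : ∀ δ → Dec (O δ))
    → (∀ δ → O δ → ∃ λ g → K g × g ⟨$⟩ʳ γ ≡ δ) → (∀ g → K g → O (g ⟨$⟩ʳ γ))
    → order ≡ count O O? * stab γ
  orbit-stabilizer γ O O? reach closed = begin
    order                                  ≡⟨ order≡∑fibre γ ⟩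
    sum (fibre γ)                          ≡⟨ sum-cong-≗ fibre-size ⟩
    sum (λ δ → χ (O? δ) * stab γ)          ≡⟨ sym (*-distribʳ-sum (stab γ) (χ ∘ O?)) ⟩
    sum (χ ∘ O?) * stab γ                  ≡⟨ cong (_* stab γ) (sym (count≡sum O O?)) ⟩
    count O O? * stab γ                    ∎
    where
    open ≡-Reasoning
    fibre-size : ∀ δ → fibre γ δ ≡ χ (O? δ) * stab γ
    fibre-size δ with O? δ
    ... | yes o with reach δ o
    ...   | g , Kg , gγ≡δ = trans (fibre-in-orbit Kg gγ≡δ) (sym (+-identityʳ _))
    fibre-size δ | no ¬o = fibre-off-orbit (λ g Kg gγ≡δ → ¬o (subst O gγ≡δ (closed g Kg)))

  fixedPointSum : ℕ
  fixedPointSum = sum (λ c → χ (member? c) * fixedPoints (decode c))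

  burnside : fixedPointSum ≡ sum stab
  burnside = begin
    sum (λ c → χ (member? c) * fixedPoints (decode c))
      ≡⟨ sum-cong-≗ (λ c → *-distribˡ-sum (χ (member? c)) (λ γ → χ (γ ≟ decode c γ))) ⟩
    sum (λ c → sum (λ γ → χ (member? c) * χ (γ ≟ decode c γ)))
      ≡⟨ ∑-comm (λ c γ → χ (member? c) * χ (γ ≟ decode c γ)) ⟩
    sum stab ∎
    where open ≡-Reasoning

  -- if every non-identity element fixes at most B points, the identity accounts for the rest
  fixedPointSum-bound : ∀ B
    → (∀ c → Represents K c → c ≢ identityCode → fixedPoints (decode c) ≤ B)
    → fixedPointSum + B ≤ n + order * B
  fixedPointSum-bound B bound =
    ≤-trans (sum-bounded-off-point member? (fixedPoints ∘ decode) represents-identity bound)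
            (+-mono-≤ (fixedPoints≤n (decode identityCode)) ≤-refl)

  stab≥2 : ∀ {γ x δ} → K x → x ⟨$⟩ʳ γ ≡ γ → x ⟨$⟩ʳ δ ≢ δ → 2 ≤ stab γ
  stab≥2 {γ} {x} {δ} Kx xγ≡γ moves =
    subst (_≤ stab γ) (cong₂ _+_ (counted represents-identity (sym (decode-encode _ γ)))
                                 (counted x-represented (sym (trans (decode-encode _ γ) xγ≡γ))))
      (sum-two distinct (λ c → χ (member? c) * χ (γ ≟ decode c γ)))
    where
    x-represented : Represents K (encode (x ⟨$⟩ʳ_))
    x-represented = x , Kx , λ i → sym (decode-encode _ i)
    distinct : identityCode ≢ encode (x ⟨$⟩ʳ_)
    distinct e = moves (sym (trans (sym (decode-encode _ δ))
                                   (trans (cong (λ c → decode c δ) e) (decode-encode _ δ))))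
    counted : ∀ {c} → Represents K c → γ ≡ decode c γ → χ (member? c) * χ (γ ≟ decode c γ) ≡ 1
    counted {c} r fixed = cong₂ _*_ (χ-yes (member? c) r) (χ-yes (γ ≟ decode c γ) fixed)

-- The polynomial identity behind the arithmetic core, in the variables
-- k = a + 2, L = 2k + b and n = 2k(k−1)m + 1 + c.
burnside-polynomial : ∀ a b c m →
  let k = suc (suc a) ; L = 2 * k + b ; n = suc (2 * k * suc a * m) + c in
  (n * L + m * (suc a * L)) + k * (m * k)
    ≡ k * (n + L * (m * k))
      + suc ((1 + a + b) + (2 + a + b) * c + m * ((2 + a) * a + b * (1 + 3 * a + a * a)))
burnside-polynomial = solve-∀

burnside-arithmetic : ∀ {k} m n L T → 2 ≤ k → 2 * k ≤ L
  → k * T ≡ n * L + m * ((k ∸ 1) * L)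
  → T + m * k ≤ n + L * (m * k)
  → ¬ (2 * k * (k ∸ 1) * m < n)
burnside-arithmetic {suc (suc a)} m n L T (s≤s (s≤s z≤n)) 2k≤L lower upper large
  with m≤n⇒∃[o]m+o≡n 2k≤L | m≤n⇒∃[o]m+o≡n large
... | b , refl | c , refl = m+1+n≰m rhs (subst (_≤ rhs) expand (*-monoʳ-≤ k upper))
  where
  k = suc (suc a)
  L′ = 2 * k + b
  n′ = suc (2 * k * suc a * m) + c
  rhs = k * (n′ + L′ * (m * k))
  excess = (1 + a + b) + (2 + a + b) * c + m * ((2 + a) * a + b * (1 + 3 * a + a * a))
  expand : k * (T + m * k) ≡ rhs + suc excess
  expand = begin
    k * (T + m * k)                            ≡⟨ *-distribˡ-+ k T (m * k) ⟩
    k * T + k * (m * k)                        ≡⟨ cong (_+ k * (m * k)) lower ⟩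
    (n′ * L′ + m * (suc a * L′)) + k * (m * k) ≡⟨ burnside-polynomial a b c m ⟩
    rhs + suc excess                           ∎
    where open ≡-Reasoning

module SchurianConfiguration {n r : ℕ} (rel : Fin n → Fin n → Fin r)
  (cc : IsCoherentConfiguration rel) {G : Permutation′ n → Set}
  (G-group : IsPermGroup G) (orbitals : OrbitalsOf rel G) where

  open IsCoherentConfiguration cc
  open IsPermGroup G-group
  open MapCodes n

  preserves : ∀ {g} → G g → ∀ a b → rel a b ≡ rel (g ⟨$⟩ʳ a) (g ⟨$⟩ʳ b)
  preserves {g} Gg a b =
    Equivalence.from (orbitals a b (g ⟨$⟩ʳ a) (g ⟨$⟩ʳ b)) (g , Gg , refl , refl)

  star-involutive : ∀ s → star (star s) ≡ s
  star-involutive s with nonempty s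
  ... | a , b , refl = trans (cong star (sym (star-spec a b))) (sym (star-spec b a))

  indistSum≡sameClass : ∀ δ δ′ → indistSum rel cc δ δ′ ≡ sum (λ γ → χ (rel δ′ γ ≟ rel δ γ))
  indistSum≡sameClass δ δ′ = begin
    sumFin (λ s → interNum rel star s (star s) δ δ′)
      ≡⟨ sumFin≡sum (λ s → interNum rel star s (star s) δ δ′) ⟩
    sum (λ s → interNum rel star s (star s) δ δ′)
      ≡⟨ sum-cong-≗ interNum-as-sum ⟩
    sum (λ s → sum (λ γ → χ (rel δ γ ≟ s) * χ (rel δ′ γ ≟ star (star s))))
      ≡⟨ ∑-comm (λ s γ → χ (rel δ γ ≟ s) * χ (rel δ′ γ ≟ star (star s))) ⟩
    sum (λ γ → sum (λ s → χ (rel δ γ ≟ s) * χ (rel δ′ γ ≟ star (star s))))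
      ≡⟨ sum-cong-≗ class-of-γ ⟩
    sum (λ γ → χ (rel δ′ γ ≟ rel δ γ)) ∎
    where
    open ≡-Reasoning
    interNum-as-sum : ∀ s → interNum rel star s (star s) δ δ′
                          ≡ sum (λ γ → χ (rel δ γ ≟ s) * χ (rel δ′ γ ≟ star (star s)))
    interNum-as-sum s =
      trans (count≡sum _ (λ γ → (rel δ γ ≟ s) ×-dec (rel δ′ γ ≟ star (star s))))
            (sum-cong-≗ (λ γ → χ-× (rel δ γ ≟ s) (rel δ′ γ ≟ star (star s))))
    -- only the class s = rel δ γ contributes
    class-of-γ : ∀ γ → sum (λ s → χ (rel δ γ ≟ s) * χ (rel δ′ γ ≟ star (star s)))
                     ≡ χ (rel δ′ γ ≟ rel δ γ)
    class-of-γ γ = trans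
      (sum-cong-≗ (λ s → cong₂ _*_ (χ-cong (rel δ γ ≟ s) (s ≟ rel δ γ) sym sym)
                                   (cong (λ t → χ (rel δ′ γ ≟ t)) (star-involutive s))))
      (sum-delta (rel δ γ) (λ s → χ (rel δ′ γ ≟ s)))

  fixedPoints≤indistSum : ∀ {c} → Represents G c → ∀ δ
    → fixedPoints (decode c) ≤ indistSum rel cc δ (decode c δ)
  fixedPoints≤indistSum {c} (π , Gπ , π≗c) δ =
    subst (fixedPoints (decode c) ≤_) (sym (indistSum≡sameClass δ (decode c δ)))
      (count-mono (λ γ → γ ≟ decode c γ) (λ γ → rel (decode c δ) γ ≟ rel δ γ) sameClass)
    where
    sameClass : ∀ γ → γ ≡ decode c γ → rel (decode c δ) γ ≡ rel δ γ
    sameClass γ fixed =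
      sym (trans (preserves Gπ δ γ) (cong₂ rel (π≗c δ) (trans (π≗c γ) (sym fixed))))

  stabilizer-group : ∀ α → IsPermGroup (Stab G α)
  stabilizer-group α = record
    { id∈  = id∈ , refl
    ; ∘∈   = λ { {π} {σ} (Gπ , πα) (Gσ , σα) → ∘∈ Gπ Gσ , trans (cong (σ ⟨$⟩ʳ_) πα) σα }
    ; inv∈ = λ { {π} (Gπ , πα) → inv∈ Gπ , trans (cong (π ⟨$⟩ˡ_) (sym πα)) (inverseˡ π) }
    ; resp = λ { {π} {σ} π≈σ (Gπ , πα) → resp π≈σ Gπ , trans (sym (π≈σ α)) πα }
    }

  thin? : ∀ s → Dec (HasValency rel s 1)
  thin? s = hasValency? rel s 1

  valency : Fin n → Fin r → ℕ
  valency α s = count (λ β → rel α β ≡ s) (λ β → rel α β ≟ s)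

  -- each thin class contributes exactly one point to α S₁
  thinPoints : ∀ α → sum (λ γ → χ (thin? (rel α γ))) ≡ numThin rel
  thinPoints α = begin
    sum (λ γ → χ (thin? (rel α γ)))
      ≡⟨ sum-cong-≗ (λ γ → sym (sum-delta (rel α γ) (χ ∘ thin?))) ⟩
    sum (λ γ → sum (λ s → χ (s ≟ rel α γ) * χ (thin? s)))
      ≡⟨ ∑-comm (λ γ s → χ (s ≟ rel α γ) * χ (thin? s)) ⟩
    sum (λ s → sum (λ γ → χ (s ≟ rel α γ) * χ (thin? s)))
      ≡⟨ sum-cong-≗ (λ s → sym (*-distribʳ-sum (χ (thin? s)) (λ γ → χ (s ≟ rel α γ)))) ⟩
    sum (λ s → sum (λ γ → χ (s ≟ rel α γ)) * χ (thin? s))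
      ≡⟨ sum-cong-≗ thinWeight ⟩
    sum (χ ∘ thin?)
      ≡⟨ sym (count≡sum (λ s → HasValency rel s 1) thin?) ⟩
    numThin rel ∎
    where
    open ≡-Reasoning
    valency-as-sum : ∀ s → sum (λ γ → χ (s ≟ rel α γ)) ≡ valency α s
    valency-as-sum s = trans (sum-cong-≗ (λ γ → χ-cong (s ≟ rel α γ) (rel α γ ≟ s) sym sym))
                             (sym (count≡sum (λ β → rel α β ≡ s) (λ β → rel α β ≟ s)))
    thinWeight : ∀ s → sum (λ γ → χ (s ≟ rel α γ)) * χ (thin? s) ≡ χ (thin? s)
    thinWeight s with thin? s
    ... | no _     = *-zeroʳ (sum (λ γ → χ (s ≟ rel α γ)))
    ... | yes thin = cong (_* 1) (trans (valency-as-sum s) (thin α))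

  -- a non-thin class has valency at least 2: it is non-empty and not of valency 1
  nonthin-valency≥2 : ∀ {α β k}
    → ¬ HasValency rel (rel α β) 1 → HasValency rel (rel α β) k → 2 ≤ k
  nonthin-valency≥2 {α} {β} {zero} _ hasK
    with subst (1 ≤_) (hasK α) (count-positive _ (λ γ → rel α γ ≟ rel α β) refl)
  ... | ()
  nonthin-valency≥2 {k = suc zero}    nonthin hasK = ⊥-elim (nonthin hasK)
  nonthin-valency≥2 {k = suc (suc _)} _       _    = s≤s (s≤s z≤n)

  module StabilizerCounting (α : Fin n) (member? : ∀ c → Dec (Represents (Stab G α) c)) where

    open GroupCounting (stabilizer-group α) member? public

    -- the G_α-orbit of γ is the set α s for s = rel α γ
    order≡valency*stab : ∀ γ → order ≡ valency α (rel α γ) * stab γ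
    order≡valency*stab γ =
      orbit-stabilizer γ (λ δ → rel α δ ≡ rel α γ) (λ δ → rel α δ ≟ rel α γ) reach closed
      where
      reach : ∀ δ → rel α δ ≡ rel α γ → ∃ λ g → Stab G α g × g ⟨$⟩ʳ γ ≡ δ
      reach δ sameClass with Equivalence.to (orbitals α γ α δ) (sym sameClass)
      ... | g , Gg , gα≡α , gγ≡δ = g , (Gg , gα≡α) , gγ≡δ
      closed : ∀ g → Stab G α g → rel α (g ⟨$⟩ʳ γ) ≡ rel α γ
      closed g (Gg , gα≡α) =
        sym (trans (preserves Gg α γ) (cong (λ a → rel a (g ⟨$⟩ʳ γ)) gα≡α))

    burnside-lower : ∀ k → 1 ≤ k → (∀ s → HasValency rel s 1 ⊎ HasValency rel s k)
      → k * sum stab ≡ n * order + numThin rel * ((k ∸ 1) * order)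
    burnside-lower k 1≤k valencies = begin
      k * sum stab
        ≡⟨ *-distribˡ-sum k stab ⟩
      sum (λ γ → k * stab γ)
        ≡⟨ sum-cong-≗ weighted ⟩
      sum (λ γ → order + χ (thin? (rel α γ)) * ((k ∸ 1) * order))
        ≡⟨ ∑-distrib-+ (λ _ → order) (λ γ → χ (thin? (rel α γ)) * ((k ∸ 1) * order)) ⟩
      sum {n} (λ _ → order) + sum (λ γ → χ (thin? (rel α γ)) * ((k ∸ 1) * order))
        ≡⟨ cong₂ _+_ (sum-const n order)
                     (sym (*-distribʳ-sum ((k ∸ 1) * order) (λ γ → χ (thin? (rel α γ))))) ⟩
      n * order + sum (λ γ → χ (thin? (rel α γ))) * ((k ∸ 1) * order)
        ≡⟨ cong (λ t → n * order + t * ((k ∸ 1) * order)) (thinPoints α) ⟩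
      n * order + numThin rel * ((k ∸ 1) * order) ∎
      where
      open ≡-Reasoning
      -- |G_αγ| is |G_α| for γ in a thin class and |G_α| / k otherwise
      weighted : ∀ γ → k * stab γ ≡ order + χ (thin? (rel α γ)) * ((k ∸ 1) * order)
      weighted γ with thin? (rel α γ)
      ... | yes thin = begin
        k * stab γ                    ≡⟨ cong (k *_) stab≡order ⟩
        k * order                     ≡⟨ cong (_* order) (sym (m+[n∸m]≡n 1≤k)) ⟩
        order + (k ∸ 1) * order       ≡⟨ cong (order +_) (sym (+-identityʳ _)) ⟩
        order + ((k ∸ 1) * order + 0) ∎
        where
        stab≡order : stab γ ≡ order
        stab≡order = sym (trans (order≡valency*stab γ)
                                (trans (cong (_* stab γ) (thin α)) (+-identityʳ (stab γ))))
      ... | no nonthin with valencies (rel α γ)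
      ...   | inj₁ thin = ⊥-elim (nonthin thin)
      ...   | inj₂ hasK = trans (sym (trans (order≡valency*stab γ) (cong (_* stab γ) (hasK α))))
                                (sym (+-identityʳ order))

    -- upper count: a non-identity element of G_α moving δ fixes at most c_δ ≤ B points
    burnside-upper : ∀ B → (∀ a b → a ≢ b → indistSum rel cc a b ≤ B) → sum stab + B ≤ n + order * B
    burnside-upper B indistBound =
      subst (λ t → t + B ≤ n + order * B) burnside (fixedPointSum-bound B bound)
      where
      bound : ∀ c → Represents (Stab G α) c → c ≢ identityCode → fixedPoints (decode c) ≤ B
      bound c (π , (Gπ , _) , π≗c) c≢id with nonidentity-moves c≢id
      ... | δ , moved = ≤-trans (fixedPoints≤indistSum (π , Gπ , π≗c) δ)
                                (indistBound δ (decode c δ) (λ δ≡ → moved (sym δ≡)))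

  -- Membership in G_α is not decidable, so
  -- the count runs under a double negation, harmless for the decidable conclusion x δ ≡ δ.
  rigidity : ∀ k → (∀ s → HasValency rel s 1 ⊎ HasValency rel s k)
    → (∀ a b → a ≢ b → indistSum rel cc a b ≤ numThin rel * k)
    → 2 * k * (k ∸ 1) * numThin rel < n
    → ∀ {α β x} → ¬ HasValency rel (rel α β) 1 → G x → x ⟨$⟩ʳ α ≡ α → x ⟨$⟩ʳ β ≡ β
    → ∀ δ → x ⟨$⟩ʳ δ ≡ δ
  rigidity k valencies indistBound large {α} {β} {x} nonthin Gx xα≡α xβ≡β δ =
    decidable-stable (x ⟨$⟩ʳ δ ≟ δ) λ moves →
      ¬¬-∀Fin (λ _ → ¬¬-excluded-middle) (λ member? → impossible member? moves)
    where
    hasK : HasValency rel (rel α β) k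
    hasK with valencies (rel α β)
    ... | inj₁ thin = ⊥-elim (nonthin thin)
    ... | inj₂ hasK = hasK
    2≤k : 2 ≤ k
    2≤k = nonthin-valency≥2 nonthin hasK
    impossible : (∀ c → Dec (Represents (Stab G α) c)) → x ⟨$⟩ʳ δ ≢ δ → ⊥
    impossible member? moves =
      burnside-arithmetic (numThin rel) n order (sum stab) 2≤k 2k≤order
        (burnside-lower k (≤-trans (s≤s z≤n) 2≤k) valencies)
        (burnside-upper (numThin rel * k) indistBound) large
      where
      open StabilizerCounting α member?
      -- |G_α| = k·|G_αβ| ≥ 2k, as x ≠ 1 lies in G_αβ
      2k≤order : 2 * k ≤ order
      2k≤order = subst₂ _≤_ (*-comm k 2)
                   (sym (trans (order≡valency*stab β) (cong (_* stab β) (hasK α))))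
                   (*-monoʳ-≤ k (stab≥2 (Gx , xα≡α) xβ≡β moves))

  conjugate-fixes : ∀ {α g x} → Conj (Stab G α) g x → x ⟨$⟩ʳ (g ⟨$⟩ʳ α) ≡ g ⟨$⟩ʳ α
  conjugate-fixes {α} {g} {x} (h , (_ , hα≡α) , x≈ghg⁻¹) = begin
    x ⟨$⟩ʳ (g ⟨$⟩ʳ α)                     ≡⟨ x≈ghg⁻¹ (g ⟨$⟩ʳ α) ⟩
    g ⟨$⟩ʳ (h ⟨$⟩ʳ (g ⟨$⟩ˡ (g ⟨$⟩ʳ α)))   ≡⟨ cong (λ y → g ⟨$⟩ʳ (h ⟨$⟩ʳ y)) (inverseˡ g) ⟩
    g ⟨$⟩ʳ (h ⟨$⟩ʳ α)                     ≡⟨ cong (g ⟨$⟩ʳ_) hα≡α ⟩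
    g ⟨$⟩ʳ α                              ∎
    where open ≡-Reasoning

  fixer-in-conjugate : ∀ {α g x}
    → G g → G x → x ⟨$⟩ʳ (g ⟨$⟩ʳ α) ≡ g ⟨$⟩ʳ α → Conj (Stab G α) g x
  fixer-in-conjugate {α} {g} {x} Gg Gx fixes =
    g ∘ₚ x ∘ₚ flip g ,
    (∘∈ Gg (∘∈ Gx (inv∈ Gg)) , trans (cong (g ⟨$⟩ˡ_) fixes) (inverseˡ g)) ,
    λ i → sym (trans (inverseʳ g) (cong (x ⟨$⟩ʳ_) (inverseʳ g)))

  stabilizer-fixes-thin : ∀ {α β x}
    → HasValency rel (rel α β) 1 → G x → x ⟨$⟩ʳ α ≡ α → x ⟨$⟩ʳ β ≡ β
  stabilizer-fixes-thin {α} {β} {x} thin Gx xα≡α =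
    count-unique (λ γ → rel α γ ≡ rel α β) (λ γ → rel α γ ≟ rel α β) (thin α)
      (sym (trans (preserves Gx α β) (cong (λ a → rel a (x ⟨$⟩ʳ β)) xα≡α))) refl

  -- G_α is a TI-subgroup: G_α^g contains G_α when rel α (g α) is thin, and meets it
  -- trivially otherwise by rigidity
  stabilizers-TI : ∀ k → (∀ s → HasValency rel s 1 ⊎ HasValency rel s k)
    → (∀ a b → a ≢ b → indistSum rel cc a b ≤ numThin rel * k)
    → 2 * k * (k ∸ 1) * numThin rel < n
    → ∀ α → IsTISubgroup G (Stab G α)
  stabilizers-TI k valencies indistBound large α g Gg with thin? (rel α (g ⟨$⟩ʳ α))
  ... | yes thin   = inj₁ λ x (Gx , xα≡α) →
    fixer-in-conjugate Gg Gx (stabilizer-fixes-thin thin Gx xα≡α)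
  ... | no nonthin = inj₂ λ x conj (Gx , xα≡α) →
    rigidity k valencies indistBound large nonthin Gx xα≡α (conjugate-fixes {α} {g} {x} conj)

  -- a homogeneous configuration has a single diagonal class, so G is transitive
  homogeneous⇒transitive : IsHomogeneous rel → IsTransitive G
  homogeneous⇒transitive (_ , diagonal , _) a b
    with Equivalence.to (orbitals a a b b) (trans (diagonal a) (sym (diagonal b)))
  ... | g , Gg , ga≡b , _ = g , Gg , ga≡b

proposition3p6 : {n r : ℕ} (rel : Fin n → Fin n → Fin r)
    → (cc : IsCoherentConfiguration rel)
    → IsHomogeneous rel
    → (k : ℕ)
    → IsPseudoTI rel cc k
    → IsSchurian rel
    → 2 * k * (k ∸ 1) * numThin rel < n
    → IsTIScheme rel
proposition3p6 rel cc homogeneous k (valencies , _ , indistBound) (G , G-group , orbitals) large =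
  G , G-group , homogeneous⇒transitive homogeneous , orbitals , stabilizers-TI k valencies indistBound large
  where open SchurianConfiguration rel cc G-group orbitals
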